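{- Let $T$ be a tree with at least two vertices, rooted at a leaf $r$, and let $L_0,L_1,\ldots,L_q$ be its levels, i.e. $L_i=\{v\in V(T):\mathrm{dist}_T(v,r)=i\}$. Then there exists an edge colouring $c:E(T)\to\mathbb{Z}_3$ such that for every $i\geq 1$ and every $u\in L_i$: (1) the multiset of colours on the edges of $T$ incident to $u$ consists of exactly one occurrence of $i-1$ and $k_u\geq 0$ occurrences of $i$, and no other colours (with $i-1$, $i$ taken modulo $3$); (2) if moreover $uv\in E(T)$ with $v\in L_{i+1}$, then the multiset of colours on the edges of $T$ incident to $u$ or $v$ consists of exactly one occurrence of $i-1$, some $k_e\geq 0$ occurrences of $i$ and some $k'_e\geq 0$ occurrences of $i+1$, and no other colours (taken modulo $3$). Consequently, $\chi'_{CF}(T)\leq 3$.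
   Context: For a graph $G$ and an edge $uv$, the closed neighbourhood $E_G[uv]$ is the set of edges incident to $u$ or to $v$ (including $uv$). An edge colouring (not necessarily proper) of $G$ is conflict-free if for every edge $e$ some colour occurs on exactly one edge of $E_G[e]$; $\chi'_{CF}(G)$ is the least number of colours admitting such a colouring. -}

module Defs where

open import Data.Nat using (ℕ; zero; suc; _+_; _∸_; _≤_; _<ᵇ_)
open import Data.Nat.DivMod using (_mod_)
open import Data.Fin using (Fin; zero; suc; toℕ; _≟_)
open import Data.Bool using (Bool; true; false; T; if_then_else_; _∧_; _∨_)
open import Data.List using (List; []; _∷_; _++_; length)
open import Data.List.Relation.Unary.Linked using (Linked)
open import Data.List.Relation.Unary.Unique.Propositional using (Unique)
open import Data.Product using (Σ; ∃; _×_)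
open import Relation.Nullary using (¬_)
open import Relation.Nullary.Decidable using (⌊_⌋)
open import Relation.Binary.PropositionalEquality using (_≡_; _≢_)

record Graph (n : ℕ) : Set where
  field
    adj     : Fin n → Fin n → Bool
    symm    : ∀ u v → adj u v ≡ adj v u
    irrefl  : ∀ u → adj u u ≡ false
open Graph public

sumF : ∀ {n} → (Fin n → ℕ) → ℕ
sumF {zero}  f = 0
sumF {suc n} f = f zero + sumF (λ x → f (suc x))

count : ∀ {n} → (Fin n → Bool) → ℕ
count p = sumF (λ x → if p x then 1 else 0)

module _ {n : ℕ} (G : Graph n) where

  data Walk : Fin n → Fin n → ℕ → Set where
    here : ∀ {u} → Walk u u 0
    step : ∀ {u w v k} → T (adj G u w) → Walk w v k → Walk u v (suc k)

  Dist : Fin n → Fin n → ℕ → Set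
  Dist u v d = Walk u v d × (∀ k → Walk u v k → d ≤ k)

  Connected : Set
  Connected = ∀ u v → ∃ λ k → Walk u v k

  HasCycle : Set
  HasCycle = Σ (Fin n) λ x → Σ (List (Fin n)) λ ys →
               (2 ≤ length ys) × Unique (x ∷ ys) ×
               Linked (λ a b → T (adj G a b)) (x ∷ (ys ++ (x ∷ [])))

  IsTree : Set
  IsTree = Connected × ¬ HasCycle

  degree : Fin n → ℕ
  degree u = count (adj G u)

  IsLeaf : Fin n → Set
  IsLeaf u = degree u ≡ 1

  eqᵇ : Fin n → Fin n → Bool
  eqᵇ a b = ⌊ a ≟ b ⌋

  IsEdgeColouring : ∀ {k} → (Fin n → Fin n → Fin k) → Set
  IsEdgeColouring c = ∀ u v → T (adj G u v) → c u v ≡ c v u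

  incCount : ∀ {k} → (Fin n → Fin n → Fin k) → Fin n → Fin k → ℕ
  incCount c u col = count (λ w → adj G u w ∧ ⌊ c u w ≟ col ⌋)

  closedCount : ∀ {k} → (Fin n → Fin n → Fin k) → Fin n → Fin n → Fin k → ℕ
  closedCount c u v col = sumF (λ a → count (λ b →
      (toℕ a <ᵇ toℕ b) ∧ adj G a b ∧
      (eqᵇ a u ∨ eqᵇ a v ∨ eqᵇ b u ∨ eqᵇ b v) ∧ ⌊ c a b ≟ col ⌋))

  IsConflictFree : ∀ {k} → (Fin n → Fin n → Fin k) → Set
  IsConflictFree {k} c = ∀ u v → T (adj G u v) →
    ∃ λ (col : Fin k) → closedCount c u v col ≡ 1

  CFChromaticIndex≤ : ℕ → Set
  CFChromaticIndex≤ k = Σ (Fin n → Fin n → Fin k) λ c →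
    IsEdgeColouring c × IsConflictFree c

_mod3 : ℕ → Fin 3
i mod3 = i mod 3

{-# OPTIONS --safe #-}
module Submission where

-- Colour every edge by the depth of its endpoint nearer to r, modulo 3.  A vertex u
-- of depth i ≥ 1 then sees colour i − 1 on its edge to the level below and colour i
-- on all other edges.  For a child v of u the edges at v carry colours i and i + 1,
-- so in E[uv] colour i − 1 occurs only on the edge from u downwards; for the edge
-- rv, r is a leaf and rv is the only edge from v downwards, so colour 0 occurs once.
-- Acyclicity enters only through the facts that adjacent vertices have different
-- depths and that a vertex has a single neighbour one level down: otherwise,
-- following lower neighbours from two vertices of equal depth until they meet
-- would close a cycle.

open import Defs
open import Data.Nat using (ℕ; zero; suc; _≤_; _<_; _∸_; _⊓_; _<ᵇ_; _+_; s≤s; z≤n)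
open import Data.Nat.Properties
  using (≤-antisym; ≤-pred; <-cmp; <-asym; <⇒≢; <-trans; n<1+n; n≤1+n; ≮⇒≥; ⊓-comm;
         m≥n⇒m⊓n≡n; m+n≡0⇒m≡0; m+n≡0⇒n≡0; 1+n≢0; suc-injective; <⇒<ᵇ; <ᵇ⇒<;
         anyUpTo?)
open import Data.Nat.Induction using (<-rec)
open import Data.Fin using (Fin; zero; suc; toℕ; _≟_)
open import Data.Fin.Properties using (toℕ-injective; any?)
  renaming (suc-injective to Fin-suc-injective)
open import Data.Bool using (Bool; true; false; T; if_then_else_; _∧_; _∨_)
open import Data.Bool.Properties using (T-∧; T-∨; ∨-comm)
open import Data.List using (List; []; _∷_; _++_; length)
open import Data.List.Relation.Unary.Linked using (Linked; [-]; _∷_)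
open import Data.List.Relation.Unary.All using (All; []; _∷_)
import Data.List.Relation.Unary.All as All
import Data.List.Relation.Unary.All.Properties as All
open import Data.List.Relation.Unary.AllPairs using ([]; _∷_)
import Data.List.Relation.Unary.AllPairs.Properties as AllPairs
open import Data.List.Relation.Unary.Unique.Propositional using (Unique)
open import Data.Product using (Σ; ∃; _×_; _,_; proj₁; proj₂)
import Data.Product as Product
open import Data.Sum using (_⊎_; inj₁; inj₂; [_,_])
import Data.Sum as Sum
open import Data.Empty using (⊥; ⊥-elim)
open import Data.Unit using (tt)
open import Function using (_∘_; id)
open import Function.Bundles using (Equivalence)
open import Relation.Nullary using (¬_; Dec; yes; no)
open import Relation.Nullary.Decidable using (⌊_⌋; _×-dec_; T?; toWitness; fromWitness)
open import Relation.Binary using (tri<; tri≈; tri>)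
open import Relation.Binary.PropositionalEquality
  using (_≡_; _≢_; refl; sym; trans; cong; cong₂; subst)

least-witness : {P : ℕ → Set} → (∀ k → Dec (P k)) → ∀ {k} → P k →
                ∃ λ d → P d × (∀ j → P j → d ≤ j)
least-witness {P} P? {k} = <-rec Goal search k
  where
  Goal : ℕ → Set
  Goal k = P k → ∃ λ d → P d × (∀ j → P j → d ≤ j)
  search : ∀ k → (∀ {j} → j < k → Goal j) → Goal k
  search k shorter pk with anyUpTo? P? k
  ... | yes (j , j<k , pj) = shorter j<k pj
  ... | no none            = k , pk , λ j pj → ≮⇒≥ (λ j<k → none (j , j<k , pj))

suc-mod3≢ : ∀ i → suc i mod3 ≢ i mod3
suc-mod3≢ 0 ()
suc-mod3≢ 1 ()
suc-mod3≢ 2 ()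
suc-mod3≢ (suc (suc (suc i))) = suc-mod3≢ i

suc-suc-mod3≢ : ∀ i → suc (suc i) mod3 ≢ i mod3
suc-suc-mod3≢ 0 ()
suc-suc-mod3≢ 1 ()
suc-suc-mod3≢ 2 ()
suc-suc-mod3≢ (suc (suc (suc i))) = suc-suc-mod3≢ i

mod3-exhaustive : ∀ i c → c ≢ i mod3 → c ≢ suc i mod3 → c ≢ suc (suc i) mod3 → ⊥
mod3-exhaustive 0 zero                h₀ h₁ h₂ = h₀ refl
mod3-exhaustive 0 (suc zero)          h₀ h₁ h₂ = h₁ refl
mod3-exhaustive 0 (suc (suc zero))    h₀ h₁ h₂ = h₂ refl
mod3-exhaustive 1 zero                h₀ h₁ h₂ = h₂ refl
mod3-exhaustive 1 (suc zero)          h₀ h₁ h₂ = h₀ refl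
mod3-exhaustive 1 (suc (suc zero))    h₀ h₁ h₂ = h₁ refl
mod3-exhaustive 2 zero                h₀ h₁ h₂ = h₁ refl
mod3-exhaustive 2 (suc zero)          h₀ h₁ h₂ = h₂ refl
mod3-exhaustive 2 (suc (suc zero))    h₀ h₁ h₂ = h₀ refl
mod3-exhaustive (suc (suc (suc i))) c = mod3-exhaustive i c

T-∧-elim : ∀ {x y} → T (x ∧ y) → T x × T y
T-∧-elim = Equivalence.to T-∧

T-∧-intro : ∀ {x y} → T x → T y → T (x ∧ y)
T-∧-intro p q = Equivalence.from T-∧ (p , q)

T-∨-elim : ∀ {x y} → T (x ∨ y) → T x ⊎ T y
T-∨-elim = Equivalence.to T-∨

T-∨-intro : ∀ {x y} → T x ⊎ T y → T (x ∨ y)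
T-∨-intro = Equivalence.from T-∨

∨-swap-pairs : ∀ p q r s → (p ∨ q ∨ r ∨ s) ≡ (q ∨ p ∨ s ∨ r)
∨-swap-pairs true  true  r s = refl
∨-swap-pairs true  false r s = refl
∨-swap-pairs false true  r s = refl
∨-swap-pairs false false r s = ∨-comm r s

indicator-T : ∀ {b} → T b → (if b then 1 else 0) ≡ 1
indicator-T {true} _ = refl

indicator-¬T : ∀ {b} → ¬ T b → (if b then 1 else 0) ≡ 0
indicator-¬T {true}  ¬b = ⊥-elim (¬b tt)
indicator-¬T {false} _  = refl

sumF-cong : ∀ {n} {f g : Fin n → ℕ} → (∀ x → f x ≡ g x) → sumF f ≡ sumF g
sumF-cong {zero}  _   = refl
sumF-cong {suc n} f≡g = cong₂ _+_ (f≡g zero) (sumF-cong (f≡g ∘ suc))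

sumF≡0 : ∀ {n} (f : Fin n → ℕ) → (∀ x → f x ≡ 0) → sumF f ≡ 0
sumF≡0 {zero}  f _   = refl
sumF≡0 {suc n} f f≡0 = cong₂ _+_ (f≡0 zero) (sumF≡0 (f ∘ suc) (f≡0 ∘ suc))

sumF≡0⇒≡0 : ∀ {n} (f : Fin n → ℕ) → sumF f ≡ 0 → ∀ x → f x ≡ 0
sumF≡0⇒≡0 f s≡0 zero    = m+n≡0⇒m≡0 (f zero) s≡0
sumF≡0⇒≡0 f s≡0 (suc x) = sumF≡0⇒≡0 (f ∘ suc) (m+n≡0⇒n≡0 (f zero) s≡0) x

sumF≡1 : ∀ {n} (f : Fin n → ℕ) {x} → f x ≡ 1 → (∀ y → y ≢ x → f y ≡ 0) → sumF f ≡ 1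
sumF≡1 f {zero}  fx≡1 f≡0 = cong₂ _+_ fx≡1 (sumF≡0 (f ∘ suc) (λ y → f≡0 (suc y) λ ()))
sumF≡1 f {suc x} fx≡1 f≡0 =
  cong₂ _+_ (f≡0 zero λ ())
    (sumF≡1 (f ∘ suc) fx≡1 (λ y y≢x → f≡0 (suc y) (y≢x ∘ Fin-suc-injective)))

count≡0 : ∀ {n} (p : Fin n → Bool) → (∀ x → ¬ T (p x)) → count p ≡ 0
count≡0 p ¬p = sumF≡0 _ (λ x → indicator-¬T (¬p x))

count≡1 : ∀ {n} (p : Fin n → Bool) {x} → T (p x) → (∀ y → T (p y) → y ≡ x) → count p ≡ 1
count≡1 p px unique = sumF≡1 _ (indicator-T px) (λ y y≢x → indicator-¬T (y≢x ∘ unique y))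

T⇒count≢0 : ∀ {n} (p : Fin n → Bool) {x} → T (p x) → count p ≢ 0
T⇒count≢0 p {x} px c≡0 = 1+n≢0 (trans (sym (indicator-T px)) (sumF≡0⇒≡0 _ c≡0 x))

count≡1⇒unique : ∀ {n} (p : Fin n → Bool) → count p ≡ 1 → ∀ {x y} → T (p x) → T (p y) → x ≡ y
count≡1⇒unique p c≡1 {zero}  {zero}  _  _  = refl
count≡1⇒unique p c≡1 {zero}  {suc y} px py with p zero
... | true  = ⊥-elim (T⇒count≢0 (p ∘ suc) py (suc-injective c≡1))
... | false = ⊥-elim px
count≡1⇒unique p c≡1 {suc x} {zero}  px py with p zero
... | true  = ⊥-elim (T⇒count≢0 (p ∘ suc) px (suc-injective c≡1))
... | false = ⊥-elim py
count≡1⇒unique p c≡1 {suc x} {suc y} px py with p zero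
... | true  = ⊥-elim (T⇒count≢0 (p ∘ suc) px (suc-injective c≡1))
... | false = cong suc (count≡1⇒unique (p ∘ suc) c≡1 px py)

sumF-count≡1 : ∀ {n} (p : Fin n → Fin n → Bool) {s t} → T (p s t) →
               (∀ a b → T (p a b) → a ≡ s × b ≡ t) → sumF (λ a → count (p a)) ≡ 1
sumF-count≡1 p pst unique =
  sumF≡1 _ (count≡1 (p _) pst (λ b pab → proj₂ (unique _ b pab)))
    (λ a a≢s → count≡0 (p a) (λ b pab → a≢s (proj₁ (unique a b pab))))

OrderedPairCount : ∀ {n} → (Fin n → Fin n → Bool) → ℕ
OrderedPairCount p = sumF (λ a → count (λ b → (toℕ a <ᵇ toℕ b) ∧ p a b))

count-increasing-pair≡1 : ∀ {n} (p : Fin n → Fin n → Bool) {s t} → toℕ s < toℕ t → T (p s t) →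
                          (∀ a b → T (p a b) → (a ≡ s × b ≡ t) ⊎ (a ≡ t × b ≡ s)) →
                          OrderedPairCount p ≡ 1
count-increasing-pair≡1 p s<t pst unique = sumF-count≡1 _ (T-∧-intro (<⇒<ᵇ s<t) pst) λ a b qab →
  let (a<b , pab) = T-∧-elim qab in
  [ id , (λ { (refl , refl) → ⊥-elim (<-asym s<t (<ᵇ⇒< _ _ a<b)) }) ] (unique a b pab)

count-ordered-pair≡1 : ∀ {n} (p : Fin n → Fin n → Bool) {s t} → s ≢ t → T (p s t) → T (p t s) →
                       (∀ a b → T (p a b) → (a ≡ s × b ≡ t) ⊎ (a ≡ t × b ≡ s)) →
                       OrderedPairCount p ≡ 1
count-ordered-pair≡1 p {s} {t} s≢t pst pts unique with <-cmp (toℕ s) (toℕ t)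
... | tri< s<t _ _ = count-increasing-pair≡1 p s<t pst unique
... | tri≈ _ s≡t _ = ⊥-elim (s≢t (toℕ-injective s≡t))
... | tri> _ _ t<s = count-increasing-pair≡1 p t<s pts (λ a b → Sum.swap ∘ unique a b)

module _ {n : ℕ} (G : Graph n) where

  Adj : Fin n → Fin n → Set
  Adj a b = T (adj G a b)

  adj-sym : ∀ {a b} → Adj a b → Adj b a
  adj-sym {a} {b} = subst T (symm G a b)

  Adj⇒≢ : ∀ {a b} → Adj a b → a ≢ b
  Adj⇒≢ {a} aa refl = subst T (irrefl G a) aa

  eqᵇ⇒≡ : ∀ {a b} → T (eqᵇ G a b) → a ≡ b
  eqᵇ⇒≡ {a} {b} = toWitness {a? = a ≟ b}

  ≡⇒eqᵇ : ∀ {a b} → a ≡ b → T (eqᵇ G a b)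
  ≡⇒eqᵇ {a} {b} = fromWitness {a? = a ≟ b}

  Incident : Fin n → Fin n → Fin n → Fin n → Bool
  Incident u v a b = eqᵇ G a u ∨ eqᵇ G a v ∨ eqᵇ G b u ∨ eqᵇ G b v

  T-Incident-elim : ∀ {u v a b} → T (Incident u v a b) → (a ≡ u ⊎ a ≡ v) ⊎ (b ≡ u ⊎ b ≡ v)
  T-Incident-elim i with T-∨-elim i
  ... | inj₁ a≡u = inj₁ (inj₁ (eqᵇ⇒≡ a≡u))
  ... | inj₂ i′ with T-∨-elim i′
  ...   | inj₁ a≡v = inj₁ (inj₂ (eqᵇ⇒≡ a≡v))
  ...   | inj₂ i″ = inj₂ (Sum.map eqᵇ⇒≡ eqᵇ⇒≡ (T-∨-elim i″))

  T-Incident-intro : ∀ {u v a b} → (a ≡ u ⊎ a ≡ v) ⊎ (b ≡ u ⊎ b ≡ v) → T (Incident u v a b)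
  T-Incident-intro (inj₁ (inj₁ a≡u)) = T-∨-intro (inj₁ (≡⇒eqᵇ a≡u))
  T-Incident-intro {u} {v} {a} (inj₁ (inj₂ a≡v)) =
    T-∨-intro {eqᵇ G a u} (inj₂ (T-∨-intro (inj₁ (≡⇒eqᵇ a≡v))))
  T-Incident-intro {u} {v} {a} {b} (inj₂ b∈uv) =
    T-∨-intro {eqᵇ G a u} (inj₂ (T-∨-intro {eqᵇ G a v}
      (inj₂ (T-∨-intro (Sum.map ≡⇒eqᵇ ≡⇒eqᵇ b∈uv)))))

  module _ {k : ℕ} (c : Fin n → Fin n → Fin k) where

    incCount≡1 : ∀ {u t col} → Adj u t → c u t ≡ col →
                 (∀ w → Adj u w → c u w ≡ col → w ≡ t) → incCount G c u col ≡ 1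
    incCount≡1 {u} {t} {col} ut cut unique =
      count≡1 _ (T-∧-intro ut (fromWitness cut)) λ w q →
        let (uw , cuw) = T-∧-elim q in unique w uw (toWitness {a? = c u w ≟ col} cuw)

    incCount≡0 : ∀ {u col} → (∀ w → Adj u w → c u w ≢ col) → incCount G c u col ≡ 0
    incCount≡0 {u} {col} avoid = count≡0 _ λ w q →
      let (uw , cuw) = T-∧-elim q in avoid w uw (toWitness {a? = c u w ≟ col} cuw)

    closedCount-comm : ∀ u v col → closedCount G c u v col ≡ closedCount G c v u col
    closedCount-comm u v col = sumF-cong λ a → sumF-cong λ b →
      cong (λ inc → if (toℕ a <ᵇ toℕ b) ∧ adj G a b ∧ inc ∧ ⌊ c a b ≟ col ⌋ then 1 else 0)
        (∨-swap-pairs (eqᵇ G a u) (eqᵇ G a v) (eqᵇ G b u) (eqᵇ G b v))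

    ClosedEdgeᵇ : Fin n → Fin n → Fin k → Fin n → Fin n → Bool
    ClosedEdgeᵇ u v col a b = adj G a b ∧ Incident u v a b ∧ ⌊ c a b ≟ col ⌋

    T-ClosedEdge-intro : ∀ {u v col a b} → Adj a b → (a ≡ u ⊎ a ≡ v) ⊎ (b ≡ u ⊎ b ≡ v) →
                         c a b ≡ col → T (ClosedEdgeᵇ u v col a b)
    T-ClosedEdge-intro {u} {v} {col} {a} {b} ab inc cab =
      T-∧-intro {adj G a b} ab (T-∧-intro {Incident u v a b} (T-Incident-intro inc) (fromWitness cab))

    closedCount≡1 : IsEdgeColouring G c → ∀ {u v t col} → Adj u t → c u t ≡ col →
                    (∀ w x → w ≡ u ⊎ w ≡ v → Adj w x → c w x ≡ col →
                       (w ≡ u × x ≡ t) ⊎ (w ≡ t × x ≡ u)) →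
                    closedCount G c u v col ≡ 1
    closedCount≡1 c-sym {u} {v} {t} {col} ut cut unique =
      count-ordered-pair≡1 (ClosedEdgeᵇ u v col) (Adj⇒≢ ut)
        (T-ClosedEdge-intro ut (inj₁ (inj₁ refl)) cut)
        (T-ClosedEdge-intro (adj-sym ut) (inj₂ (inj₁ refl)) (trans (sym (c-sym u t ut)) cut))
        only
      where
      only : ∀ a b → T (ClosedEdgeᵇ u v col a b) → (a ≡ u × b ≡ t) ⊎ (a ≡ t × b ≡ u)
      only a b q with T-∧-elim q
      ... | ab , q′ with T-∧-elim q′
      ...   | inc , cab′ with T-Incident-elim inc | toWitness {a? = c a b ≟ col} cab′
      ...     | inj₁ a∈uv | cab = unique a b a∈uv ab cab
      ...     | inj₂ b∈uv | cab =
        [ (λ (b≡u , a≡t) → inj₂ (a≡t , b≡u)) , (λ (b≡t , a≡u) → inj₁ (a≡u , b≡t)) ]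
          (unique b a b∈uv (adj-sym ab) (trans (sym (c-sym a b ab)) cab))

Linked-snoc : ∀ {A : Set} {R : A → A → Set} {x y z} (M : List A) →
              Linked R (x ∷ M ++ y ∷ []) → R y z → Linked R (x ∷ (M ++ y ∷ []) ++ z ∷ [])
Linked-snoc []      (xy ∷ [-]) yz = xy ∷ yz ∷ [-]
Linked-snoc (_ ∷ M) (xm ∷ L)   yz = xm ∷ Linked-snoc M L yz

2≤length-between : ∀ {A : Set} {a b : A} (M : List A) → 2 ≤ length (a ∷ M ++ b ∷ [])
2≤length-between []      = s≤s (s≤s z≤n)
2≤length-between (_ ∷ _) = s≤s (s≤s z≤n)

walk0⇒≡ : ∀ {n} {G : Graph n} {u v} → Walk G u v 0 → u ≡ v
walk0⇒≡ here = refl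

module Levels {n : ℕ} (G : Graph n) (connected : Connected G) (r : Fin n) where

  walk? : ∀ k u v → Dec (Walk G u v k)
  walk? zero u v with u ≟ v
  ... | yes refl = yes here
  ... | no  u≢v  = no λ { here → u≢v refl }
  walk? (suc k) u v with any? (λ w → T? (adj G u w) ×-dec walk? k w v)
  ... | yes (w , uw , p) = yes (step uw p)
  ... | no  no-step      = no λ { (step uw p) → no-step (_ , uw , p) }

  distance : ∀ u → ∃ (Dist G u r)
  distance u = least-witness (λ k → walk? k u r) (proj₂ (connected u r))

  depth : Fin n → ℕ
  depth u = proj₁ (distance u)

  depth-walk : ∀ u → Walk G u r (depth u)
  depth-walk u = proj₁ (proj₂ (distance u))

  depth-minimal : ∀ u {k} → Walk G u r k → depth u ≤ k
  depth-minimal u p = proj₂ (proj₂ (distance u)) _ p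

  Dist⇒depth : ∀ {u i} → Dist G u r i → depth u ≡ i
  Dist⇒depth {u} (p , minimal) = ≤-antisym (depth-minimal u p) (minimal _ (depth-walk u))

  depth≡0⇒root : ∀ {u} → depth u ≡ 0 → u ≡ r
  depth≡0⇒root {u} d≡0 = walk0⇒≡ (subst (Walk G u r) d≡0 (depth-walk u))

  depth-root : depth r ≡ 0
  depth-root = Dist⇒depth (here , λ _ _ → z≤n)

  depth-adj-≤ : ∀ {a b} → Adj G a b → depth b ≤ suc (depth a)
  depth-adj-≤ {a} {b} ab = depth-minimal b (step (adj-sym G ab) (depth-walk a))

  lower-neighbour : ∀ {u i} → depth u ≡ suc i → ∃ λ p → Adj G u p × depth p ≡ i
  lower-neighbour {u} {i} du with subst (Walk G u r) du (depth-walk u)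
  ... | step {w = p} up p-walk =
    p , up , ≤-antisym (depth-minimal p p-walk)
                       (≤-pred (subst (_≤ suc (depth p)) du (depth-adj-≤ (adj-sym G up))))

  Above : ℕ → List (Fin n) → Set
  Above i = All (λ w → i < depth w)

  shallower⇒≢ : ∀ {x w i} → depth x ≡ i → i < depth w → x ≢ w
  shallower⇒≢ dx i<dw refl = <⇒≢ i<dw (sym dx)

  unique-between : ∀ {i a b} M → depth a ≡ i → depth b ≡ i → a ≢ b → Unique M → Above i M →
                   Unique (a ∷ M ++ b ∷ [])
  unique-between M da db a≢b unique-M above =
    All.++⁺ (All.map (shallower⇒≢ da) above) (a≢b ∷ []) ∷
    AllPairs.++⁺ unique-M ([] ∷ [])
      (All.map (λ i<dw → (λ w≡b → shallower⇒≢ db i<dw (sym w≡b)) ∷ []) above)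

  above-between : ∀ {i a b} M → depth a ≡ suc i → depth b ≡ suc i → Above (suc i) M →
                  Above i (a ∷ M ++ b ∷ [])
  above-between {i} M da db above =
    subst (i <_) (sym da) (n<1+n i) ∷
    All.++⁺ (All.map (<-trans (n<1+n i)) above) (subst (i <_) (sym db) (n<1+n i) ∷ [])

  -- Replacing the two ends of the path by their lower neighbours lowers the level by one;
  -- at level 0 both ends would be r, so the ends must meet earlier and close a cycle.
  level-path⇒cycle : ∀ i {a b} → depth a ≡ i → depth b ≡ i → a ≢ b →
                     ∀ M → Unique M → Above i M → Linked (Adj G) (a ∷ M ++ b ∷ []) → HasCycle G
  level-path⇒cycle zero da db a≢b _ _ _ _ =
    ⊥-elim (a≢b (trans (depth≡0⇒root da) (sym (depth≡0⇒root db))))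
  level-path⇒cycle (suc i) {a} {b} da db a≢b M unique-M above path
    with lower-neighbour da | lower-neighbour db
  ... | p , ap , dp | q , bq , dq = climb (p ≟ q)
    where
    M′ : List (Fin n)
    M′ = a ∷ M ++ b ∷ []
    extended : Linked (Adj G) (p ∷ M′ ++ q ∷ [])
    extended = adj-sym G ap ∷ Linked-snoc M path bq
    climb : Dec (p ≡ q) → HasCycle G
    climb (yes refl) = p , M′ , 2≤length-between {a = a} {b = b} M ,
      (All.map (shallower⇒≢ dp) (above-between M da db above) ∷
       unique-between M da db a≢b unique-M above) ,
      extended
    climb (no p≢q) = level-path⇒cycle i dp dq p≢q M′
      (unique-between M da db a≢b unique-M above) (above-between M da db above) extended

  colour : Fin n → Fin n → Fin 3
  colour a b = (depth a ⊓ depth b) mod3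

  colour-edge : IsEdgeColouring G colour
  colour-edge a b _ = cong _mod3 (⊓-comm (depth a) (depth b))

  lower-edge-colour : ∀ {u p j} → depth u ≡ suc j → depth p ≡ j → colour u p ≡ j mod3
  lower-edge-colour {j = j} du dp rewrite du | dp = cong _mod3 (m≥n⇒m⊓n≡n (n≤1+n j))

  module Acyclic (acyclic : ¬ HasCycle G) where

    depth-adj-≢ : ∀ {a b} → Adj G a b → depth a ≢ depth b
    depth-adj-≢ {a} ab da≡db =
      acyclic (level-path⇒cycle (depth a) refl (sym da≡db) (Adj⇒≢ G ab) [] [] [] (ab ∷ [-]))

    lower-neighbour-unique : ∀ {u p q i} → Adj G u p → Adj G u q → depth p ≡ i → depth q ≡ i →
                             depth u ≡ suc i → p ≡ q
    lower-neighbour-unique {u} {p} {q} {i} up uq dp dq du with p ≟ q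
    ... | yes p≡q = p≡q
    ... | no  p≢q = ⊥-elim (acyclic (level-path⇒cycle i dp dq p≢q (u ∷ []) ([] ∷ [])
                      (subst (i <_) (sym du) (n<1+n i) ∷ []) (adj-sym G up ∷ uq ∷ [-])))

    adjacent-levels : ∀ {a b} → Adj G a b → depth b ≡ suc (depth a) ⊎ depth a ≡ suc (depth b)
    adjacent-levels {a} {b} ab with <-cmp (depth a) (depth b)
    ... | tri< a<b _ _ = inj₁ (≤-antisym (depth-adj-≤ ab) a<b)
    ... | tri≈ _ a≡b _ = ⊥-elim (depth-adj-≢ ab a≡b)
    ... | tri> _ _ b<a = inj₂ (≤-antisym (depth-adj-≤ (adj-sym G ab)) b<a)

    neighbour-colour : ∀ {z w k} → depth z ≡ suc k → Adj G z w →
                       (depth w ≡ k × colour z w ≡ k mod3) ⊎ colour z w ≡ suc k mod3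
    neighbour-colour {z} {w} dz zw with adjacent-levels zw
    ... | inj₁ dw = inj₂ (trans (colour-edge z w zw) (lower-edge-colour (trans dw (cong suc dz)) dz))
    ... | inj₂ dz′ = inj₁ (dw , lower-edge-colour dz dw)
      where dw = suc-injective (trans (sym dz′) dz)

    only-lower-edge : ∀ {u p w j} → depth u ≡ suc j → Adj G u p → depth p ≡ j →
                      Adj G u w → colour u w ≡ j mod3 → w ≡ p
    only-lower-edge {j = j} du up dp uw cuw with neighbour-colour du uw
    ... | inj₁ (dw , _) = lower-neighbour-unique uw up dw dp du
    ... | inj₂ cuw′     = ⊥-elim (suc-mod3≢ j (trans (sym cuw′) cuw))

    incCount-lower : ∀ {u j} → depth u ≡ suc j → incCount G colour u (j mod3) ≡ 1
    incCount-lower du with lower-neighbour du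
    ... | p , up , dp = incCount≡1 G colour up (lower-edge-colour du dp)
                          (λ w uw cuw → only-lower-edge du up dp uw cuw)

    incCount-other : ∀ {u j} → depth u ≡ suc j → ∀ col → col ≢ j mod3 → col ≢ suc j mod3 →
                     incCount G colour u col ≡ 0
    incCount-other du col col≢j col≢j+1 = incCount≡0 G colour λ w uw cuw →
      [ (λ (_ , cuw′) → col≢j (trans (sym cuw) cuw′)) , (λ cuw′ → col≢j+1 (trans (sym cuw) cuw′)) ]
        (neighbour-colour du uw)

    closedCount-lower : ∀ {u v j} → depth u ≡ suc j → Adj G u v → depth v ≡ suc (suc j) →
                        closedCount G colour u v (j mod3) ≡ 1
    closedCount-lower {u} {v} {j} du uv dv with lower-neighbour du
    ... | p , up , dp = closedCount≡1 G colour colour-edge up (lower-edge-colour du dp) only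
      where
      only : ∀ w x → w ≡ u ⊎ w ≡ v → Adj G w x → colour w x ≡ j mod3 →
             (w ≡ u × x ≡ p) ⊎ (w ≡ p × x ≡ u)
      only w x (inj₁ refl) wx cwx = inj₁ (refl , only-lower-edge du up dp wx cwx)
      only w x (inj₂ refl) wx cwx with neighbour-colour dv wx
      ... | inj₁ (_ , cwx′) = ⊥-elim (suc-mod3≢ j (trans (sym cwx′) cwx))
      ... | inj₂ cwx′       = ⊥-elim (suc-suc-mod3≢ j (trans (sym cwx′) cwx))

    module Leaf (leaf : IsLeaf G r) where

      closedCount-root : ∀ {v} → Adj G r v → closedCount G colour r v zero ≡ 1
      closedCount-root {v} rv = closedCount≡1 G colour colour-edge rv crv only
        where
        dv : depth v ≡ 1
        dv with adjacent-levels rv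
        ... | inj₁ dv = trans dv (cong suc depth-root)
        ... | inj₂ dr = ⊥-elim (1+n≢0 (trans (sym dr) depth-root))
        crv : colour r v ≡ zero
        crv = trans (colour-edge r v rv) (lower-edge-colour dv depth-root)
        only : ∀ w x → w ≡ r ⊎ w ≡ v → Adj G w x → colour w x ≡ zero →
               (w ≡ r × x ≡ v) ⊎ (w ≡ v × x ≡ r)
        only w x (inj₁ refl) wx _   = inj₁ (refl , count≡1⇒unique (adj G r) leaf wx rv)
        only w x (inj₂ refl) wx cwx = inj₂ (refl , only-lower-edge dv (adj-sym G rv) depth-root wx cwx)

      closedCount-unique-colour : ∀ {u v k} → depth u ≡ k → Adj G u v → depth v ≡ suc k →
                                  ∃ λ col → closedCount G colour u v col ≡ 1
      closedCount-unique-colour {k = zero} du uv dv with depth≡0⇒root du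
      ... | refl = zero , closedCount-root uv
      closedCount-unique-colour {k = suc j} du uv dv = j mod3 , closedCount-lower du uv dv

      conflict-free : IsConflictFree G colour
      conflict-free a b ab with adjacent-levels ab
      ... | inj₁ db = closedCount-unique-colour refl ab db
      ... | inj₂ da = Product.map₂ (trans (closedCount-comm G colour a b _))
                        (closedCount-unique-colour refl (adj-sym G ab) da)

lemma1 : (n : ℕ) → 2 ≤ n → (G : Graph n) → IsTree G → (r : Fin n) → IsLeaf G r →
    Σ (Fin n → Fin n → Fin 3) (λ c → IsEdgeColouring G c ×
      (∀ (i : ℕ) → 1 ≤ i → (u : Fin n) → Dist G u r i →
        (incCount G c u ((i ∸ 1) mod3) ≡ 1) ×
        (∀ col → col ≢ (i ∸ 1) mod3 → col ≢ i mod3 → incCount G c u col ≡ 0) ×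
        (∀ (v : Fin n) → T (adj G u v) → Dist G v r (suc i) →
          (closedCount G c u v ((i ∸ 1) mod3) ≡ 1) ×
          (∀ col → col ≢ (i ∸ 1) mod3 → col ≢ i mod3 → col ≢ (suc i) mod3 →
            closedCount G c u v col ≡ 0))))
    × CFChromaticIndex≤ G 3
lemma1 n _ G (connected , acyclic) r leaf =
  (colour , colour-edge , λ where
    (suc j) _ u u∈L → let du = Dist⇒depth u∈L in
      incCount-lower du , incCount-other du , λ v uv v∈L →
        closedCount-lower du uv (Dist⇒depth v∈L) ,
        -- with only three colours this clause is vacuous
        λ col h₀ h₁ h₂ → ⊥-elim (mod3-exhaustive j col h₀ h₁ h₂)) ,
  (colour , colour-edge , conflict-free)
  where
  open Levels G connected r
  open Acyclic acyclic
  open Leaf leaf
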